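{- Let $G$ be a finite group and $H$ a non-trivial normal subgroup of $G$. Let $\kappa$ and $\tau$ be integers satisfying $0\leq\kappa\leq|H|-1$, $1\leq\tau\leq|H|$ and $\gcd(2,|H|-1)\mid\kappa$. Then $H$ is a $(\kappa,\tau)$-regular set of $G$ if and only if $H$ is a $(0,\tau)$-regular set of $G$.
   Context: All graphs are finite, undirected and simple. For a finite group $G$ and an inverse-closed subset $X\subseteq G\setminus\{1\}$, the Cayley graph $\mathrm{Cay}(G,X)$ has vertex set $G$ and edge set $\{\{g,gx\}: g\in G, x\in X\}$. For nonnegative integers $\kappa,\tau$, a subset $R$ of the vertex set of a graph $\Gamma$ is a $(\kappa,\tau)$-regular set of $\Gamma$ if every vertex in $R$ is adjacent to exactly $\kappa$ vertices of $R$ and every vertex outside $R$ is adjacent to exactly $\tau$ vertices of $R$. A subset $R\subseteq G$ is a $(\kappa,\tau)$-regular set of $G$ if there is a Cayley graph $\Gamma$ on $G$ such that $R$ is a $(\kappa,\tau)$-regular set of $\Gamma$. -}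

module Defs where

open import Data.Nat using (ℕ)
open import Data.Fin using (Fin)
open import Data.Fin.Subset using (Subset; _∈_; _∉_; _∩_; ∣_∣; inside; outside)
open import Data.Vec using (tabulate; lookup)
open import Data.Product using (Σ; ∃; _×_; _,_)
open import Relation.Binary.PropositionalEquality using (_≡_; _≢_)

-- A finite group of order n, represented on the carrier Fin n
-- (every finite group is isomorphic to one of this form).
record FinGroup (n : ℕ) : Set where
  field
    _∙_   : Fin n → Fin n → Fin n
    e     : Fin n
    _⁻¹   : Fin n → Fin n
    assoc : ∀ x y z → (x ∙ y) ∙ z ≡ x ∙ (y ∙ z)
    idˡ   : ∀ x → e ∙ x ≡ x
    idʳ   : ∀ x → x ∙ e ≡ x
    invˡ  : ∀ x → (x ⁻¹) ∙ x ≡ e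
    invʳ  : ∀ x → x ∙ (x ⁻¹) ≡ e

module _ {n : ℕ} (G : FinGroup n) where
  open FinGroup G

  IsNormalSubgroup : Subset n → Set
  IsNormalSubgroup H =
    (e ∈ H)
    × (∀ x y → x ∈ H → y ∈ H → (x ∙ y) ∈ H)
    × (∀ x → x ∈ H → (x ⁻¹) ∈ H)
    × (∀ g h → h ∈ H → ((g ∙ h) ∙ (g ⁻¹)) ∈ H)

  NonTrivial : Subset n → Set
  NonTrivial H = ∃ λ h → h ∈ H × h ≢ e

  IsConnectionSet : Subset n → Set
  IsConnectionSet X = (e ∉ X) × (∀ x → x ∈ X → (x ⁻¹) ∈ X)

  -- neighbourhood of g in Cay(G,X): { g' | g⁻¹ g' ∈ X } = { g x | x ∈ X }
  nbhd : Subset n → Fin n → Subset n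
  nbhd X g = tabulate (λ y → lookup X ((g ⁻¹) ∙ y))

  IsRegularSetOfCay : Subset n → ℕ → ℕ → Subset n → Set
  IsRegularSetOfCay X κ τ R =
    (∀ g → g ∈ R → ∣ nbhd X g ∩ R ∣ ≡ κ)
    × (∀ g → g ∉ R → ∣ nbhd X g ∩ R ∣ ≡ τ)

  IsRegularSetOfGroup : ℕ → ℕ → Subset n → Set
  IsRegularSetOfGroup κ τ R =
    Σ (Subset n) λ X → IsConnectionSet X × IsRegularSetOfCay X κ τ R

-- Replacing the part of a connection set X that lies inside H does not affect the
-- neighbourhoods in H of vertices outside H: for g ∉ H the elements of gX in H come from
-- X ∖ H.  Taking X′ = (X ∖ H) ∪ Y with Y ⊆ H ∖ {e} inverse-closed, each g ∈ H has exactly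
-- |gY| = |Y| neighbours in H.  So H is (κ,τ)-regular as soon as it is (0,τ)-regular and
-- H ∖ {e} has an inverse-closed subset of size κ; this exists when κ ≤ |H| - 1 and κ is even
-- or H ∖ {e} has an involution, which is automatic when |H| - 1 is odd, since
-- non-involutions come in pairs {x, x⁻¹}.
module Submission where

open import Defs
open import Algebra.Bundles using (Group)
open import Algebra.Definitions using (Involutive)
import Algebra.Properties.Group as GroupProperties
open import Data.Bool using (Bool; if_then_else_)
open import Data.Fin using (Fin; _≟_)
open import Data.Fin.Permutation using (Permutation′; permutation; _⟨$⟩ʳ_)
open import Data.Fin.Properties using (any?)
open import Data.Fin.Subset
  using (Subset; _∈_; _∉_; _⊆_; _⊂_; _-_; _─_; _∪_; _∩_; ∣_∣; ⊥; inside; outside; Nonempty)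
open import Data.Fin.Subset.Induction using (⊂-wellFounded; Acc; acc)
open import Data.Fin.Subset.Properties
  using (_∈?_; ⊥⊆; ∉⊥; ⊆-trans; ⊆-antisym; ⊂-trans; x∈⁅x⁆; x∈p∧x≢y⇒x∈p-y; x∈p∧x∉q⇒x∈p─q;
         p─⊥≡p; p─q⊆p; ∣⊥∣≡0; x∈p⇒p-x⊂p; nonempty?; Empty-unique;
         x∈p∩q⁺; x∈p∩q⁻; x∈p∪q⁺; x∈p∪q⁻)
open import Data.Nat using (ℕ; zero; suc; _+_; _∸_; _≤_; _<_; s≤s; z≤n)
open import Data.Nat.Divisibility
  using (_∣_; _∤_; _∣?_; _∣0; ∣1⇒≡1; ∣m+n∣m⇒∣n; ∣m∣n⇒∣m+n; ∣-refl; ∣-trans)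
open import Data.Nat.GCD using (gcd; gcd-greatest)
open import Data.Nat.Properties
  using (+-0-commutativeMonoid; ≤∧≢⇒<; ≤-trans; ≤-pred; suc-injective; +-comm; m≤n⇒m<n∨m≡n)
  renaming (_≟_ to _≟ℕ_)
open import Algebra.Properties.CommutativeMonoid.Sum +-0-commutativeMonoid
  using (sum; sum-permute; sum-cong-≗)
open import Data.Product using (∃; _×_; _,_; proj₁; proj₂)
import Data.Product as Product
open import Data.Sum using (_⊎_; inj₁; inj₂)
import Data.Sum as Sum
open import Data.Vec using ([]; _∷_; here; there; lookup; tabulate)
open import Data.Vec.Properties using (lookup∘tabulate; []=⇒lookup; lookup⇒[]=)
open import Function using (_∘_)
open import Function.Bundles using (_⇔_; mk⇔)
open import Level using (0ℓ)
open import Relation.Binary.PropositionalEquality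
open import Relation.Nullary using (¬_; yes; no; contradiction)
open import Relation.Nullary.Decidable using (_×-dec_; ¬?)

private
  variable
    n : ℕ

x∈p─q⇒x∉q : ∀ {x : Fin n} {p q : Subset n} → x ∈ p ─ q → x ∉ q
x∈p─q⇒x∉q {p = _ ∷ _} {q = outside ∷ _} here      ()
x∈p─q⇒x∉q {p = _ ∷ _} {q = _ ∷ _}       (there x∈) (there x∈q) = x∈p─q⇒x∉q x∈ x∈q

suc∣p-x∣≡∣p∣ : ∀ {x : Fin n} {p : Subset n} → x ∈ p → suc ∣ p - x ∣ ≡ ∣ p ∣
suc∣p-x∣≡∣p∣ {p = inside ∷ p}  here         = cong (λ q → suc ∣ q ∣) (p─⊥≡p p)
suc∣p-x∣≡∣p∣ {p = inside ∷ p}  (there x∈p) = cong suc (suc∣p-x∣≡∣p∣ x∈p)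
suc∣p-x∣≡∣p∣ {p = outside ∷ p} (there x∈p) = suc∣p-x∣≡∣p∣ x∈p

x∈p-y⇒x≢y : ∀ {x y : Fin n} {p : Subset n} → x ∈ p - y → x ≢ y
x∈p-y⇒x≢y {x = x} x∈p-y refl = x∈p─q⇒x∉q x∈p-y (x∈⁅x⁆ x)

0<∣p∣⇒Nonempty : ∀ {p : Subset n} → 0 < ∣ p ∣ → Nonempty p
0<∣p∣⇒Nonempty {n} {p} 0<∣p∣ with nonempty? p
... | yes p≢∅ = p≢∅
... | no p≡∅  = contradiction (subst (λ q → 0 < ∣ q ∣) (Empty-unique p≡∅) 0<∣p∣)
                              (subst (λ m → ¬ 0 < m) (sym (∣⊥∣≡0 n)) (λ ()))

2∣n⇒2∤1+n : ∀ {m} → 2 ∣ m → 2 ∤ suc m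
2∣n⇒2∤1+n {m} 2∣m 2∣1+m =
  contradiction (∣1⇒≡1 (∣m+n∣m⇒∣n (subst (2 ∣_) (+-comm 1 m) 2∣1+m) 2∣m)) (λ ())

gcd[2,m]∣k⇒2∣k⊎2∤m : ∀ {m k} → gcd 2 m ∣ k → 2 ∣ k ⊎ 2 ∤ m
gcd[2,m]∣k⇒2∣k⊎2∤m {m} {k} gcd∣k with 2 ∣? k
... | yes 2∣k = inj₁ 2∣k
... | no 2∤k  = inj₂ (λ 2∣m → 2∤k (∣-trans (gcd-greatest ∣-refl 2∣m) gcd∣k))

module InverseClosedSubsets {n : ℕ} (_⁻¹ : Fin n → Fin n) (⁻¹-involutive : Involutive _≡_ _⁻¹) where

  InverseClosed : Subset n → Set
  InverseClosed S = ∀ x → x ∈ S → x ⁻¹ ∈ S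

  HasSelfInverse : Subset n → Set
  HasSelfInverse S = ∃ λ x → x ∈ S × x ⁻¹ ≡ x

  InverseClosedSubsetOfSize : ℕ → Subset n → Set
  InverseClosedSubsetOfSize k S = ∃ λ Y → Y ⊆ S × InverseClosed Y × ∣ Y ∣ ≡ k

  InverseClosed-⊥ : InverseClosed ⊥
  InverseClosed-⊥ _ x∈⊥ = contradiction x∈⊥ ∉⊥

  ⁻¹-injective : ∀ {x y} → x ⁻¹ ≡ y ⁻¹ → x ≡ y
  ⁻¹-injective {x} {y} eq = trans (sym (⁻¹-involutive x)) (trans (cong _⁻¹ eq) (⁻¹-involutive y))

  ⁻¹-swap : ∀ {x y} → x ⁻¹ ≡ y → x ≡ y ⁻¹
  ⁻¹-swap {x} eq = trans (sym (⁻¹-involutive x)) (cong _⁻¹ eq)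

  InverseClosed-removeSelfInverse : ∀ {S x} → InverseClosed S → x ⁻¹ ≡ x → InverseClosed (S - x)
  InverseClosed-removeSelfInverse {S} {x} closed x⁻¹≡x y y∈S-x =
    x∈p∧x≢y⇒x∈p-y (closed y (p─q⊆p S _ y∈S-x))
      (λ y⁻¹≡x → x∈p-y⇒x≢y y∈S-x (trans (⁻¹-swap y⁻¹≡x) x⁻¹≡x))

  InverseClosed-removePair : ∀ {S x} → InverseClosed S → InverseClosed (S - x - x ⁻¹)
  InverseClosed-removePair {S} {x} closed y y∈S″ =
    x∈p∧x≢y⇒x∈p-y (x∈p∧x≢y⇒x∈p-y (closed y y∈S)
      (λ y⁻¹≡x → x∈p-y⇒x≢y y∈S″ (⁻¹-swap y⁻¹≡x)))
      (λ y⁻¹≡x⁻¹ → x∈p-y⇒x≢y y∈S′ (⁻¹-injective y⁻¹≡x⁻¹))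
    where
    y∈S′ : y ∈ S - x
    y∈S′ = p─q⊆p (S - x) _ y∈S″
    y∈S : y ∈ S
    y∈S = p─q⊆p S _ y∈S′

  HasSelfInverse-removePair : ∀ {S x} → x ⁻¹ ≢ x → HasSelfInverse S → HasSelfInverse (S - x - x ⁻¹)
  HasSelfInverse-removePair {x = x} x⁻¹≢x (i , i∈S , i⁻¹≡i) =
    i , x∈p∧x≢y⇒x∈p-y (x∈p∧x≢y⇒x∈p-y i∈S i≢x) i≢x⁻¹ , i⁻¹≡i
    where
    i≢x : i ≢ x
    i≢x refl = x⁻¹≢x i⁻¹≡i
    i≢x⁻¹ : i ≢ x ⁻¹
    i≢x⁻¹ refl = x⁻¹≢x (trans (sym i⁻¹≡i) (⁻¹-involutive x))

  ∣S-x-x⁻¹∣ : ∀ {S x} → InverseClosed S → x ∈ S → x ⁻¹ ≢ x → suc (suc ∣ S - x - x ⁻¹ ∣) ≡ ∣ S ∣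
  ∣S-x-x⁻¹∣ {S} {x} closed x∈S x⁻¹≢x =
    trans (cong suc (suc∣p-x∣≡∣p∣ x⁻¹∈S-x)) (suc∣p-x∣≡∣p∣ x∈S)
    where
    x⁻¹∈S-x : x ⁻¹ ∈ S - x
    x⁻¹∈S-x = x∈p∧x≢y⇒x∈p-y (closed x x∈S) x⁻¹≢x

  -- Without self-inverse elements S splits into pairs {x, x⁻¹}.
  even-size : ∀ {S} → InverseClosed S → (∀ x → x ∈ S → x ⁻¹ ≢ x) → 2 ∣ ∣ S ∣
  even-size {S} = go S (⊂-wellFounded S)
    where
    go : ∀ S → Acc _⊂_ S → InverseClosed S → (∀ x → x ∈ S → x ⁻¹ ≢ x) → 2 ∣ ∣ S ∣
    go S (acc rec) closed noSelfInverse with nonempty? S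
    ... | no S≡∅ = subst (2 ∣_) (sym (trans (cong ∣_∣ (Empty-unique S≡∅)) (∣⊥∣≡0 n))) (2 ∣0)
    ... | yes (x , x∈S) = subst (2 ∣_) (∣S-x-x⁻¹∣ closed x∈S x⁻¹≢x) (∣m∣n⇒∣m+n ∣-refl rest)
      where
      x⁻¹≢x : x ⁻¹ ≢ x
      x⁻¹≢x = noSelfInverse x x∈S
      S″⊂S : S - x - x ⁻¹ ⊂ S
      S″⊂S = ⊂-trans (x∈p⇒p-x⊂p (x∈p∧x≢y⇒x∈p-y (closed x x∈S) x⁻¹≢x)) (x∈p⇒p-x⊂p x∈S)
      rest : 2 ∣ ∣ S - x - x ⁻¹ ∣
      rest = go (S - x - x ⁻¹) (rec S″⊂S) (InverseClosed-removePair closed)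
                (λ y y∈S″ → noSelfInverse y (proj₁ S″⊂S y∈S″))

  odd-size⇒HasSelfInverse : ∀ {S} → InverseClosed S → 2 ∤ ∣ S ∣ → HasSelfInverse S
  odd-size⇒HasSelfInverse {S} closed odd with any? (λ x → x ∈? S ×-dec x ⁻¹ ≟ x)
  ... | yes selfInverse = selfInverse
  ... | no none = contradiction (even-size closed (λ x x∈S x⁻¹≡x → none (x , x∈S , x⁻¹≡x))) odd

  InverseClosedSubsetOfSize-mono : ∀ {k S T} → S ⊆ T →
                                   InverseClosedSubsetOfSize k S → InverseClosedSubsetOfSize k T
  InverseClosedSubsetOfSize-mono S⊆T (Y , Y⊆S , closed , ∣Y∣≡k) = Y , ⊆-trans Y⊆S S⊆T , closed , ∣Y∣≡k

  removeSelfInverse : ∀ {k S} → InverseClosed S → HasSelfInverse S → ∣ S ∣ ≡ suc k →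
                      InverseClosedSubsetOfSize k S
  removeSelfInverse {S = S} closed (i , i∈S , i⁻¹≡i) ∣S∣≡1+k =
    S - i , p─q⊆p S _ , InverseClosed-removeSelfInverse closed i⁻¹≡i ,
    suc-injective (trans (suc∣p-x∣≡∣p∣ i∈S) ∣S∣≡1+k)

  -- Remove pairs {x, x⁻¹} while possible; a self-inverse element absorbs a parity mismatch.
  inverseClosedSubsetOfSize : ∀ {k S} → InverseClosed S → k ≤ ∣ S ∣ → 2 ∣ k ⊎ HasSelfInverse S →
                              InverseClosedSubsetOfSize k S
  inverseClosedSubsetOfSize {S = S} = go S (⊂-wellFounded S)
    where
    go : ∀ S {k} → Acc _⊂_ S → InverseClosed S → k ≤ ∣ S ∣ → 2 ∣ k ⊎ HasSelfInverse S →
         InverseClosedSubsetOfSize k S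
    go S {zero} _ _ _ _ = ⊥ , ⊥⊆ , InverseClosed-⊥ , ∣⊥∣≡0 n
    go S {suc k} (acc rec) closed 1+k≤∣S∣ parity with suc k ≟ℕ ∣ S ∣
    ... | yes 1+k≡∣S∣ = S , (λ x∈S → x∈S) , closed , sym 1+k≡∣S∣
    ... | no 1+k≢∣S∣ with any? (λ x → x ∈? S ×-dec ¬? (x ⁻¹ ≟ x))
    ...   | yes (x , x∈S , x⁻¹≢x) = removePair
      where
      S″⊂S : S - x - x ⁻¹ ⊂ S
      S″⊂S = ⊂-trans (x∈p⇒p-x⊂p (x∈p∧x≢y⇒x∈p-y (closed x x∈S) x⁻¹≢x)) (x∈p⇒p-x⊂p x∈S)
      ∣S∣≡2+∣S″∣ : ∣ S ∣ ≡ suc (suc ∣ S - x - x ⁻¹ ∣)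
      ∣S∣≡2+∣S″∣ = sym (∣S-x-x⁻¹∣ closed x∈S x⁻¹≢x)
      k≤∣S″∣ : k ≤ ∣ S - x - x ⁻¹ ∣
      k≤∣S″∣ = ≤-pred (≤-pred (subst (suc (suc k) ≤_) ∣S∣≡2+∣S″∣ (≤∧≢⇒< 1+k≤∣S∣ 1+k≢∣S∣)))
      removePair : InverseClosedSubsetOfSize (suc k) S
      removePair with m≤n⇒m<n∨m≡n k≤∣S″∣
      ... | inj₁ k<∣S″∣ = InverseClosedSubsetOfSize-mono (proj₁ S″⊂S)
              (go (S - x - x ⁻¹) (rec S″⊂S) (InverseClosed-removePair closed) k<∣S″∣
                  (Sum.map₂ (HasSelfInverse-removePair x⁻¹≢x) parity))
      ... | inj₂ k≡∣S″∣ = removeSelfInverse closed selfInverse ∣S∣≡2+k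
        where
        ∣S∣≡2+k : ∣ S ∣ ≡ suc (suc k)
        ∣S∣≡2+k = trans ∣S∣≡2+∣S″∣ (cong (λ m → suc (suc m)) (sym k≡∣S″∣))
        selfInverse : HasSelfInverse S
        selfInverse = Sum.[ (λ 2∣1+k → odd-size⇒HasSelfInverse closed
                                         (subst (2 ∤_) (sym ∣S∣≡2+k) (2∣n⇒2∤1+n 2∣1+k)))
                          , (λ i → i) ]′ parity
    ...   | no noPair = removeAny (0<∣p∣⇒Nonempty (≤-trans (s≤s z≤n) 1+k<∣S∣))
      where
      1+k<∣S∣ : suc k < ∣ S ∣
      1+k<∣S∣ = ≤∧≢⇒< 1+k≤∣S∣ 1+k≢∣S∣
      selfInverse : ∀ {x} → x ∈ S → x ⁻¹ ≡ x
      selfInverse {x} x∈S with x ⁻¹ ≟ x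
      ... | yes x⁻¹≡x = x⁻¹≡x
      ... | no x⁻¹≢x = contradiction (x , x∈S , x⁻¹≢x) noPair
      removeAny : Nonempty S → InverseClosedSubsetOfSize (suc k) S
      removeAny (x , x∈S) = InverseClosedSubsetOfSize-mono (proj₁ S′⊂S)
          (go (S - x) (rec S′⊂S) (InverseClosed-removeSelfInverse closed (selfInverse x∈S)) k<∣S′∣
              (inj₂ (Product.map₂ (λ y∈S′ → y∈S′ , selfInverse (proj₁ S′⊂S y∈S′))
                                  (0<∣p∣⇒Nonempty (≤-trans (s≤s z≤n) k<∣S′∣)))))
        where
        S′⊂S : S - x ⊂ S
        S′⊂S = x∈p⇒p-x⊂p x∈S
        k<∣S′∣ : k < ∣ S - x ∣
        k<∣S′∣ = ≤-pred (subst (suc (suc k) ≤_) (sym (suc∣p-x∣≡∣p∣ x∈S)) 1+k<∣S∣)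

∣p∣≡sum : ∀ (p : Subset n) → ∣ p ∣ ≡ sum (λ i → if lookup p i then 1 else 0)
∣p∣≡sum []            = refl
∣p∣≡sum (inside ∷ p)  = cong suc (∣p∣≡sum p)
∣p∣≡sum (outside ∷ p) = ∣p∣≡sum p

∣p∘π∣≡∣p∣ : ∀ (π : Permutation′ n) (p : Subset n) → ∣ tabulate (λ i → lookup p (π ⟨$⟩ʳ i)) ∣ ≡ ∣ p ∣
∣p∘π∣≡∣p∣ {n} π p = begin
  ∣ p∘π ∣                                       ≡⟨ ∣p∣≡sum p∘π ⟩
  sum (λ i → indicator (lookup p∘π i))          ≡⟨ sum-cong-≗ (cong indicator ∘ lookup∘tabulate π*p) ⟩
  sum (λ i → indicator (lookup p (π ⟨$⟩ʳ i)))   ≡⟨ sum-permute (λ i → indicator (lookup p i)) π ⟨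
  sum (λ i → indicator (lookup p i))            ≡⟨ ∣p∣≡sum p ⟨
  ∣ p ∣                                          ∎
  where
  open ≡-Reasoning
  π*p : Fin n → Bool
  π*p i = lookup p (π ⟨$⟩ʳ i)
  p∘π : Subset n
  p∘π = tabulate π*p
  indicator : Bool → ℕ
  indicator b = if b then 1 else 0

module _ {n : ℕ} (G : FinGroup n) where
  open FinGroup G

  asGroup : Group 0ℓ 0ℓ
  asGroup = record
    { isGroup = record
      { isMonoid = record
        { isSemigroup = record
          { isMagma = record { isEquivalence = isEquivalence ; ∙-cong = cong₂ _∙_ }
          ; assoc   = assoc }
        ; identity = idˡ , idʳ }
      ; inverse = invˡ , invʳ
      ; ⁻¹-cong = cong _⁻¹ } }

  open GroupProperties asGroup
    using (⁻¹-involutive; ε⁻¹≈ε; \\-leftDividesˡ; \\-leftDividesʳ; //-rightDividesʳ)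
  open InverseClosedSubsets _⁻¹ ⁻¹-involutive public

  ∈-nbhd⁺ : ∀ X {g y} → (g ⁻¹) ∙ y ∈ X → y ∈ nbhd G X g
  ∈-nbhd⁺ X {g} {y} z∈X = lookup⇒[]= y _ (trans (lookup∘tabulate _ y) ([]=⇒lookup z∈X))

  ∈-nbhd⁻ : ∀ X {g y} → y ∈ nbhd G X g → (g ⁻¹) ∙ y ∈ X
  ∈-nbhd⁻ X {g} {y} y∈nbhd = lookup⇒[]= _ X (trans (sym (lookup∘tabulate _ y)) ([]=⇒lookup y∈nbhd))

  ∣nbhd∣ : ∀ X g → ∣ nbhd G X g ∣ ≡ ∣ X ∣
  ∣nbhd∣ X g = ∣p∘π∣≡∣p∣ (permutation ((g ⁻¹) ∙_) (g ∙_) (\\-leftDividesʳ g) (\\-leftDividesˡ g)) X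

  IsSubgroup : Subset n → Set
  IsSubgroup H = (e ∈ H) × (∀ x y → x ∈ H → y ∈ H → (x ∙ y) ∈ H) × (∀ x → x ∈ H → (x ⁻¹) ∈ H)

  normal⇒subgroup : ∀ {H} → IsNormalSubgroup G H → IsSubgroup H
  normal⇒subgroup (e∈H , ∙-closed , ⁻¹-closed , _) = e∈H , ∙-closed , ⁻¹-closed

  module Subgroup {H : Subset n} (isSubgroup : IsSubgroup H) where

    e∈H : e ∈ H
    e∈H = proj₁ isSubgroup

    ∙-closed : ∀ {x y} → x ∈ H → y ∈ H → x ∙ y ∈ H
    ∙-closed = proj₁ (proj₂ isSubgroup) _ _

    ⁻¹-closed : ∀ {x} → x ∈ H → x ⁻¹ ∈ H
    ⁻¹-closed = proj₂ (proj₂ isSubgroup) _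

    ⁻¹-reflects : ∀ {x} → x ⁻¹ ∈ H → x ∈ H
    ⁻¹-reflects {x} x⁻¹∈H = subst (_∈ H) (⁻¹-involutive x) (⁻¹-closed x⁻¹∈H)

    \\-closed : ∀ {g y} → g ∈ H → y ∈ H → (g ⁻¹) ∙ y ∈ H
    \\-closed g∈H y∈H = ∙-closed (⁻¹-closed g∈H) y∈H

    \\-reflects : ∀ {g y} → g ∈ H → (g ⁻¹) ∙ y ∈ H → y ∈ H
    \\-reflects {g} {y} g∈H g⁻¹y∈H = subst (_∈ H) (\\-leftDividesˡ g y) (∙-closed g∈H g⁻¹y∈H)

    \\-outside : ∀ {g y} → g ∉ H → y ∈ H → (g ⁻¹) ∙ y ∉ H
    \\-outside {g} {y} g∉H y∈H g⁻¹y∈H =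
      g∉H (⁻¹-reflects (subst (_∈ H) (//-rightDividesʳ y (g ⁻¹)) (∙-closed g⁻¹y∈H (⁻¹-closed y∈H))))

    nbhd-replaceInside-inside : ∀ {X Y g} → Y ⊆ H → g ∈ H → nbhd G ((X ─ H) ∪ Y) g ∩ H ≡ nbhd G Y g
    nbhd-replaceInside-inside {X} {Y} {g} Y⊆H g∈H = ⊆-antisym into from
      where
      into : nbhd G ((X ─ H) ∪ Y) g ∩ H ⊆ nbhd G Y g
      into y∈ with x∈p∩q⁻ _ H y∈
      ... | y∈nbhd , y∈H with x∈p∪q⁻ (X ─ H) Y (∈-nbhd⁻ ((X ─ H) ∪ Y) y∈nbhd)
      ...   | inj₁ z∈X─H = contradiction (\\-closed g∈H y∈H) (x∈p─q⇒x∉q z∈X─H)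
      ...   | inj₂ z∈Y   = ∈-nbhd⁺ Y z∈Y
      from : nbhd G Y g ⊆ nbhd G ((X ─ H) ∪ Y) g ∩ H
      from y∈nbhd = x∈p∩q⁺ (∈-nbhd⁺ ((X ─ H) ∪ Y) (x∈p∪q⁺ (inj₂ z∈Y)) , \\-reflects g∈H (Y⊆H z∈Y))
        where
        z∈Y : (g ⁻¹) ∙ _ ∈ Y
        z∈Y = ∈-nbhd⁻ Y y∈nbhd

    nbhd-replaceInside-outside : ∀ {X Y g} → Y ⊆ H → g ∉ H → nbhd G ((X ─ H) ∪ Y) g ∩ H ≡ nbhd G X g ∩ H
    nbhd-replaceInside-outside {X} {Y} {g} Y⊆H g∉H = ⊆-antisym into from
      where
      into : nbhd G ((X ─ H) ∪ Y) g ∩ H ⊆ nbhd G X g ∩ H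
      into y∈ with x∈p∩q⁻ _ H y∈
      ... | y∈nbhd , y∈H with x∈p∪q⁻ (X ─ H) Y (∈-nbhd⁻ ((X ─ H) ∪ Y) y∈nbhd)
      ...   | inj₁ z∈X─H = x∈p∩q⁺ (∈-nbhd⁺ X (p─q⊆p X H z∈X─H) , y∈H)
      ...   | inj₂ z∈Y   = contradiction (Y⊆H z∈Y) (\\-outside g∉H y∈H)
      from : nbhd G X g ∩ H ⊆ nbhd G ((X ─ H) ∪ Y) g ∩ H
      from y∈ with x∈p∩q⁻ _ H y∈
      ... | y∈nbhd , y∈H =
        x∈p∩q⁺ (∈-nbhd⁺ ((X ─ H) ∪ Y) (x∈p∪q⁺ (inj₁ z∈X─H)) , y∈H)
        where
        z∈X─H : (g ⁻¹) ∙ _ ∈ X ─ H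
        z∈X─H = x∈p∧x∉q⇒x∈p─q (∈-nbhd⁻ X y∈nbhd) (\\-outside g∉H y∈H)

    connectionSet-replaceInside : ∀ {X Y} → IsConnectionSet G X → Y ⊆ H - e → InverseClosed Y →
                                  IsConnectionSet G ((X ─ H) ∪ Y)
    connectionSet-replaceInside {X} {Y} (e∉X , X-closed) Y⊆H-e Y-closed = e∉X′ , X′-closed
      where
      e∉X′ : e ∉ (X ─ H) ∪ Y
      e∉X′ e∈X′ with x∈p∪q⁻ (X ─ H) Y e∈X′
      ... | inj₁ e∈X─H = x∈p─q⇒x∉q e∈X─H e∈H
      ... | inj₂ e∈Y   = x∈p-y⇒x≢y (Y⊆H-e e∈Y) refl
      X′-closed : InverseClosed ((X ─ H) ∪ Y)
      X′-closed x x∈X′ with x∈p∪q⁻ (X ─ H) Y x∈X′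
      ... | inj₁ x∈X─H = x∈p∪q⁺ (inj₁ (x∈p∧x∉q⇒x∈p─q (X-closed x (p─q⊆p X H x∈X─H))
                                                  (λ x⁻¹∈H → x∈p─q⇒x∉q x∈X─H (⁻¹-reflects x⁻¹∈H))))
      ... | inj₂ x∈Y   = x∈p∪q⁺ (inj₂ (Y-closed x x∈Y))

    regularSet-replaceInside : ∀ {κ τ Y} → IsRegularSetOfGroup G κ τ H → Y ⊆ H - e → InverseClosed Y →
                               IsRegularSetOfGroup G ∣ Y ∣ τ H
    regularSet-replaceInside {τ = τ} {Y = Y} (X , isConnectionSet , _ , outer) Y⊆H-e Y-closed =
      (X ─ H) ∪ Y , connectionSet-replaceInside isConnectionSet Y⊆H-e Y-closed , inner′ , outer′
      where
      Y⊆H : Y ⊆ H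
      Y⊆H y∈Y = p─q⊆p H _ (Y⊆H-e y∈Y)
      inner′ : ∀ g → g ∈ H → ∣ nbhd G ((X ─ H) ∪ Y) g ∩ H ∣ ≡ ∣ Y ∣
      inner′ g g∈H = trans (cong ∣_∣ (nbhd-replaceInside-inside {X} Y⊆H g∈H)) (∣nbhd∣ Y g)
      outer′ : ∀ g → g ∉ H → ∣ nbhd G ((X ─ H) ∪ Y) g ∩ H ∣ ≡ τ
      outer′ g g∉H = trans (cong ∣_∣ (nbhd-replaceInside-outside {X} Y⊆H g∉H)) (outer g g∉H)

    H-e-inverseClosed : InverseClosed (H - e)
    H-e-inverseClosed = InverseClosed-removeSelfInverse (λ _ → ⁻¹-closed) ε⁻¹≈ε

    inverseClosedSubsetOfSize-H-e : ∀ {κ} → κ + 1 ≤ ∣ H ∣ → gcd 2 (∣ H ∣ ∸ 1) ∣ κ →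
                                    InverseClosedSubsetOfSize κ (H - e)
    inverseClosedSubsetOfSize-H-e {κ} κ<∣H∣ gcd∣κ =
      inverseClosedSubsetOfSize H-e-inverseClosed κ≤∣H-e∣
        (Sum.map₂ (odd-size⇒HasSelfInverse H-e-inverseClosed ∘ subst (2 ∤_) ∣H∣∸1≡∣H-e∣)
                  (gcd[2,m]∣k⇒2∣k⊎2∤m gcd∣κ))
      where
      ∣H∣≡1+∣H-e∣ : ∣ H ∣ ≡ suc ∣ H - e ∣
      ∣H∣≡1+∣H-e∣ = sym (suc∣p-x∣≡∣p∣ e∈H)
      ∣H∣∸1≡∣H-e∣ : ∣ H ∣ ∸ 1 ≡ ∣ H - e ∣
      ∣H∣∸1≡∣H-e∣ = cong (_∸ 1) ∣H∣≡1+∣H-e∣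
      κ≤∣H-e∣ : κ ≤ ∣ H - e ∣
      κ≤∣H-e∣ = ≤-pred (subst₂ _≤_ (+-comm κ 1) ∣H∣≡1+∣H-e∣ κ<∣H∣)

lemma2p3 : {n : ℕ} (G : FinGroup n) (H : Subset n) (κ τ : ℕ)
    → IsNormalSubgroup G H
    → NonTrivial G H
    → κ + 1 ≤ ∣ H ∣
    → 1 ≤ τ
    → τ ≤ ∣ H ∣
    → gcd 2 (∣ H ∣ ∸ 1) ∣ κ
    → IsRegularSetOfGroup G κ τ H ⇔ IsRegularSetOfGroup G 0 τ H
lemma2p3 {n} G H κ τ isNormal _ κ<∣H∣ _ _ gcd∣κ = mk⇔ toZero fromZero
  where
  open Subgroup G (normal⇒subgroup G isNormal)
  toZero : IsRegularSetOfGroup G κ τ H → IsRegularSetOfGroup G 0 τ H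
  toZero regular = subst (λ k → IsRegularSetOfGroup G k τ H) (∣⊥∣≡0 n)
                         (regularSet-replaceInside regular ⊥⊆ (InverseClosed-⊥ G))
  fromZero : IsRegularSetOfGroup G 0 τ H → IsRegularSetOfGroup G κ τ H
  fromZero regular with inverseClosedSubsetOfSize-H-e κ<∣H∣ gcd∣κ
  ... | Y , Y⊆H-e , Y-closed , ∣Y∣≡κ = subst (λ k → IsRegularSetOfGroup G k τ H) ∣Y∣≡κ
                                             (regularSet-replaceInside regular Y⊆H-e Y-closed)
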